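{- Let $\pi$ be an (untyped) $\mathbf{mL^3}$ proof net. Then the relation $\preceq$ on the boxes of $\pi$ is a partial order.
   Context: Untyped meLL proof nets: graphs of links axiom, cut, tensor, par, for all, exists, paragraph, of course, flat, pax, why not, with exponential boxes (each of course link is the principal port of exactly one box, whose other border links are pax links called auxiliary ports; boxes are disjoint or nested), satisfying the Danos–Regnier correctness criterion: every switching (choosing for each par link one premise, collapsing depth-zero boxes to nodes) is acyclic, recursively inside boxes. The exponential branch of a flat link is the directed path from its conclusion through pax links to a why not link. An indexing is a map from edges to $\mathbb Z$ such that axiom conclusions, cut premises, and premises/conclusion of tensor, par, quantifier, pax and why not links have equal index, the premise of an of course, paragraph or flat link has index one more than its conclusion, and all conclusions of the net have equal index; $\mathbf{mL^3}$ = proof nets admitting one. Using the canonical indexing (the unique one $\ge0$ and vanishing on some edge of each component), the level of a box is the index of the conclusion of its principal port. For boxes $\mathcal B,\mathcal C$, $\mathcal B\prec_1\mathcal C$ iff they have the same level, the principal port of $\mathcal B$ is cut with a why not link $w$, and $\mathcal C$ contains a flat link whose exponential branch ends in $w$; $\preceq$ is the reflexive-transitive closure of $\prec_1$. -}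

module Defs where

open import Data.Nat using (ℕ; zero; suc; _+_)
open import Data.Integer as ℤ using (ℤ; +_)
open import Data.Fin using (Fin; zero; suc; _≟_)
open import Data.Bool using (Bool; true; false; if_then_else_)
open import Data.Maybe using (Maybe; just; nothing)
open import Data.List using (List; []; _∷_)
open import Data.List.Relation.Unary.AllPairs using (AllPairs)
open import Data.Product using (Σ; ∃; ∃-syntax; _×_; _,_)
open import Data.Sum using (_⊎_; inj₁; inj₂)
open import Data.Empty using (⊥)
open import Relation.Nullary using (¬_; does)
open import Relation.Binary.PropositionalEquality using (_≡_; _≢_)
open import Relation.Binary.Construct.Closure.ReflexiveTransitive using (Star)

count : ∀ {n} → (Fin n → Bool) → ℕ
count {zero}  p = 0
count {suc n} p = (if p zero then 1 else 0) + count (λ i → p (suc i))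

data Kind : Set where
  ax cut tens par all ex para ofc flat pax wn : Kind
  -- axiom, cut, tensor, par, for all, exists, paragraph (§),
  -- of course (!), flat (♭), pax, why not (?)

-- number of premises (nothing = arbitrary, for why not links)
premArity : Kind → Maybe ℕ
premArity ax   = just 0
premArity cut  = just 2
premArity tens = just 2
premArity par  = just 2
premArity all  = just 1
premArity ex   = just 1
premArity para = just 1
premArity ofc  = just 1
premArity flat = just 1
premArity pax  = just 1
premArity wn   = nothing

conclArity : Kind → ℕ
conclArity ax  = 2
conclArity cut = 0
conclArity _   = 1

shift : Kind → ℤ
shift para = + 1
shift ofc  = + 1
shift flat = + 1
shift _    = + 0

-- Each edge is the conclusion of exactly one link (src) and the premise
-- of at most one link (tgt; nothing = conclusion of the net).
-- Boxes are indexed by Fin nB; principal b is the of course link of b;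
-- border l = just b iff l is a border link (principal or pax) of b;
-- inside b l = true iff l lies in the content of b (at any depth,
-- border links of b excluded).

record PreNet : Set where
  field
    nL nE nB  : ℕ
    kind      : Fin nL → Kind
    src       : Fin nE → Fin nL
    tgt       : Fin nE → Maybe (Fin nL)
    principal : Fin nB → Fin nL
    border    : Fin nL → Maybe (Fin nB)
    inside    : Fin nB → Fin nL → Bool

module _ (π : PreNet) where
  open PreNet π

  isPremOf : Fin nL → Fin nE → Bool
  isPremOf l e with tgt e
  ... | just t  = does (t ≟ l)
  ... | nothing = false

  isConclOf : Fin nL → Fin nE → Bool
  isConclOf l e = does (src e ≟ l)

  Inside : Fin nB → Fin nL → Set
  Inside b l = inside b l ≡ true

  Full : Fin nB → Fin nL → Set
  Full b l = Inside b l ⊎ border l ≡ just b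

  ArityOK : Fin nL → Set
  ArityOK l = (∀ k → premArity (kind l) ≡ just k → count (isPremOf l) ≡ k)
            × count (isConclOf l) ≡ conclArity (kind l)

  record WellFormed : Set where
    field
      arity          : ∀ l → ArityOK l
      principal-ofc  : ∀ b → kind (principal b) ≡ ofc
      principal-bord : ∀ b → border (principal b) ≡ just b
      ofc-principal  : ∀ l b → border l ≡ just b → kind l ≡ ofc → l ≡ principal b
      ofc-has-box    : ∀ l → kind l ≡ ofc → ∃[ b ] border l ≡ just b
      pax-has-box    : ∀ l → kind l ≡ pax → ∃[ b ] border l ≡ just b
      border-kind    : ∀ l b → border l ≡ just b → kind l ≡ ofc ⊎ kind l ≡ pax
      border-outside : ∀ l b → border l ≡ just b → inside b l ≡ false
      nesting        : ∀ b c → b ≢ c →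
                         (∀ l → Full b l → Inside c l)
                       ⊎ (∀ l → Full c l → Inside b l)
                       ⊎ (∀ l → Full b l → ¬ Full c l)
      -- the content of a box, with the premises of its border links
      -- as conclusions, is a closed sub-net
      box-prem-in    : ∀ b e l → tgt e ≡ just l → Full b l → Inside b (src e)
      box-concl-in   : ∀ b e → Inside b (src e) → ∃[ l ] (tgt e ≡ just l × Full b l)

  -- Danos–Regnier correctness, recursively inside boxes.
  -- A region is the top level (nothing) or the content of a box.

  Region : Set
  Region = Maybe (Fin nB)

  DirectlyIn : Region → Fin nL → Set
  DirectlyIn nothing  l = ∀ b → inside b l ≡ false
  DirectlyIn (just b) l = Inside b l × (∀ c → Inside c l → Inside b (principal c) → ⊥)

  -- vertices of switching graphs: links, or collapsed boxes
  Vtx : Set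
  Vtx = Fin nL ⊎ Fin nB

  vtx : Fin nL → Vtx
  vtx l with border l
  ... | just c  = inj₂ c
  ... | nothing = inj₁ l

  IsSwitching : (Fin nL → Fin nE) → Set
  IsSwitching S = ∀ l → kind l ≡ par → tgt (S l) ≡ just l

  Kept : (Fin nL → Fin nE) → Fin nE → Set
  Kept S e = ∀ t → tgt e ≡ just t → kind t ≡ par → S t ≡ e

  Joins : Region → (Fin nL → Fin nE) → Fin nE → Vtx → Vtx → Set
  Joins R S e u v =
    DirectlyIn R (src e) × Kept S e ×
    ∃[ t ] (tgt e ≡ just t × DirectlyIn R t ×
            ((u ≡ vtx (src e) × v ≡ vtx t) ⊎ (u ≡ vtx t × v ≡ vtx (src e))))

  data Walk (R : Region) (S : Fin nL → Fin nE) : Vtx → Vtx → List (Fin nE) → Set where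
    [] : ∀ {u} → Walk R S u u []
    _∷_ : ∀ {u v w e es} → Joins R S e u v → Walk R S v w es → Walk R S u w (e ∷ es)

  HasCycle : Region → (Fin nL → Fin nE) → Set
  HasCycle R S = ∃[ u ] ∃[ e ] ∃[ es ] (Walk R S u u (e ∷ es) × AllPairs _≢_ (e ∷ es))

  Correct : Set
  Correct = ∀ (R : Region) S → IsSwitching S → ¬ HasCycle R S

  ProofNet : Set
  ProofNet = WellFormed × Correct

  Prem : Fin nE → Fin nL → Set
  Prem e l = tgt e ≡ just l

  Concl : Fin nE → Fin nL → Set
  Concl e l = src e ≡ l

  IsIndexing : (Fin nE → ℤ) → Set
  IsIndexing I =
      (∀ l e e' → Prem e l → Prem e' l → I e ≡ I e')
    × (∀ l e e' → Concl e l → Concl e' l → I e ≡ I e')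
    × (∀ l e e' → Prem e l → Concl e' l → I e ≡ I e' ℤ.+ shift (kind l))
    × (∀ e e' → tgt e ≡ nothing → tgt e' ≡ nothing → I e ≡ I e')

  mL3 : Set
  mL3 = ∃[ I ] IsIndexing I

  Adj : Fin nE → Fin nE → Set
  Adj e e' = src e ≡ src e' ⊎ tgt e ≡ just (src e') ⊎ tgt e' ≡ just (src e)
           ⊎ ∃[ t ] (tgt e ≡ just t × tgt e' ≡ just t)

  Canonical : (Fin nE → ℤ) → Set
  Canonical I = IsIndexing I × (∀ e → + 0 ℤ.≤ I e)
              × (∀ e → ∃[ e' ] (Star Adj e e' × I e' ≡ + 0))

  data BranchTo (w : Fin nL) : Fin nE → Set where
    here  : ∀ {e} → tgt e ≡ just w → BranchTo w e
    there : ∀ {e e' p} → tgt e ≡ just p → kind p ≡ pax → src e' ≡ p →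
            BranchTo w e' → BranchTo w e

  BranchEndsIn : Fin nL → Fin nL → Set
  BranchEndsIn f w = kind f ≡ flat × kind w ≡ wn × ∃[ e ] (src e ≡ f × BranchTo w e)

  Prec1 : (Fin nE → ℤ) → Fin nB → Fin nB → Set
  Prec1 I B C =
    ∃[ cB ] ∃[ cC ] ∃[ k ] ∃[ d ] ∃[ w ]
      ( src cB ≡ principal B × src cC ≡ principal C × I cB ≡ I cC
      × tgt cB ≡ just k × kind k ≡ cut
      × tgt d ≡ just k × d ≢ cB × src d ≡ w × kind w ≡ wn
      × ∃[ f ] (Inside C f × BranchEndsIn f w))

  Preceq : (Fin nE → ℤ) → Fin nB → Fin nB → Set
  Preceq I = Star (Prec1 I)

module Submission where

-- The relation ⪯ on the boxes of a correct net is the reflexive-transitive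
-- closure of ≺₁, hence a preorder; the content of the theorem is antisymmetry,
-- i.e. that ≺₁ has no cycles.  Given a cycle, rotate it to start at a box Y of
-- minimal depth and shortcut it to an elementary cycle.  Every step X ≺₁ X′
-- yields the path  X —c— cut —d— ?w —x— A  of the switching graph of the region
-- R where Y lies, where A is the box lying directly in R around X′ through whose
-- pax port x the exponential branch enters w; steps inside A are skipped.  These
-- segments chain into a closed walk whose edges are pairwise distinct, because
-- each edge determines the box of the cycle it comes from; this contradicts the
-- Danos–Regnier criterion.

open import Defs
open import Data.Nat using (ℕ; zero; suc; _+_; _≤_; _<_; z≤n; s≤s)
open import Data.Nat.Properties using (≤-refl; m≤n⇒m≤1+n; <-irrefl; <-≤-trans; <-trans)
open import Data.Integer using (ℤ)
open import Data.Fin using (Fin; zero; suc; _≟_)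
open import Data.Fin.Properties using (any?)
open import Data.Unit using (⊤; tt)
open import Data.Bool using (Bool; true; false; if_then_else_)
open import Data.Bool.Properties using (¬-not) renaming (_≟_ to _≟B_)
open import Data.List using (List; []; _∷_; length; _++_; filter; allFin)
open import Data.List.Extrema.Nat using (argmin; argmin-sel; f[argmin]≤f[⊤]; f[argmin]≤f[xs]; argmax; argmax-all; f[xs]≤f[argmax])
open import Data.List.Relation.Unary.All using (All; []; _∷_; lookup)
import Data.List.Relation.Unary.All as All
import Data.List.Relation.Unary.All.Properties as All
open import Data.List.Relation.Unary.All.Properties using (¬Any⇒All¬; All¬⇒¬Any; all-filter; anti-mono)
open import Data.List.Relation.Unary.AllPairs using ([]; _∷_)
open import Data.List.Relation.Unary.Unique.Propositional using (Unique)
import Data.List.Relation.Unary.Unique.Propositional.Properties as Unique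
open import Data.List.Relation.Binary.Disjoint.Propositional using (Disjoint)
open import Data.List.Relation.Unary.Any using (here; there)
open import Data.List.Relation.Binary.Subset.Propositional using (_⊆_)
open import Data.List.Relation.Binary.Subset.Propositional.Properties using (⊆-refl; ⊆-trans; ∷⁺ʳ)
open import Data.List.Membership.Propositional using (_∈_)
open import Data.List.Membership.Propositional.Properties using (∈-++⁺ˡ; ∈-++⁺ʳ; ∈-++⁻; ∈-filter⁺; ∈-allFin)
open import Data.Product using (Σ; ∃-syntax; _×_; _,_; proj₁; proj₂)
open import Data.Sum using (_⊎_; inj₁; inj₂)
open import Data.Empty using (⊥; ⊥-elim)
open import Data.Maybe using (just; nothing)
open import Function using (_∘_)
open import Relation.Nullary using (¬_; Dec; does; yes; no)
open import Relation.Nullary.Decidable using (dec-true)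
open import Relation.Binary.Definitions using (DecidableEquality; Antisymmetric)
open import Relation.Binary.Structures using (IsPartialOrder)
open import Relation.Binary.Construct.Closure.ReflexiveTransitive.Properties using (isPreorder)
open import Relation.Binary.PropositionalEquality using (_≡_; _≢_; refl; sym; trans; cong; subst)
open import Relation.Binary.Construct.Closure.ReflexiveTransitive using (Star; ε; _◅_; _◅◅_)

true≢false : true ≢ false
true≢false ()

just≢nothing : ∀ {A : Set} {a : A} → just a ≢ nothing
just≢nothing ()

unique-suffix : ∀ {A : Set} (xs : List A) {ys : List A} → Unique (xs ++ ys) → Unique ys
unique-suffix []       u       = u
unique-suffix (_ ∷ xs) (_ ∷ u) = unique-suffix xs u

remove : ∀ {n} → Fin n → (Fin n → Bool) → Fin n → Bool
remove i p j = if does (j ≟ i) then false else p j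

remove-other : ∀ {n} {p : Fin n → Bool} {x y} → x ≢ y → p y ≡ true → remove x p y ≡ true
remove-other {x = x} {y} x≢y py with y ≟ x
... | yes y≡x = ⊥-elim (x≢y (sym y≡x))
... | no _    = py

count-remove : ∀ {n} (p : Fin n → Bool) i → p i ≡ true → count p ≡ suc (count (remove i p))
count-remove p zero    pi rewrite pi = refl
count-remove p (suc i) pi with p zero
... | true  = cong suc (count-remove (λ j → p (suc j)) i pi)
... | false = count-remove (λ j → p (suc j)) i pi

count-mono : ∀ {n} (p q : Fin n → Bool) → (∀ i → p i ≡ true → q i ≡ true) → count p ≤ count q
count-mono {zero}  p q p⇒q = z≤n
count-mono {suc n} p q p⇒q with p zero in p0 | q zero in q0
... | true  | true  = s≤s (count-mono _ _ (λ i → p⇒q (suc i)))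
... | false | true  = m≤n⇒m≤1+n (count-mono _ _ (λ i → p⇒q (suc i)))
... | false | false = count-mono _ _ (λ i → p⇒q (suc i))
... | true  | false with () ← trans (sym (p⇒q zero p0)) q0

count-strict : ∀ {n} (p q : Fin n → Bool) i → (∀ j → p j ≡ true → q j ≡ true) →
               p i ≡ false → q i ≡ true → count p < count q
count-strict p q i p⇒q pi qi rewrite count-remove q i qi = s≤s (count-mono p (remove i q) p⇒q∖i)
  where
  p⇒q∖i : ∀ j → p j ≡ true → remove i q j ≡ true
  p⇒q∖i j pj = remove-other {p = q} (λ { refl → true≢false (trans (sym pj) pi) }) (p⇒q j pj)

count-distinct : ∀ {n} (p : Fin n → Bool) (xs : List (Fin n)) → Unique xs →
                 All (λ i → p i ≡ true) xs → length xs ≤ count p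
count-distinct p []       _          _          = z≤n
count-distinct p (x ∷ xs) (x∉ ∷ u) (px ∷ pxs) rewrite count-remove p x px =
  s≤s (count-distinct (remove x p) xs u (still-passing x∉ pxs))
  where
  still-passing : ∀ {ys} → All (x ≢_) ys → All (λ i → p i ≡ true) ys → All (λ i → remove x p i ≡ true) ys
  still-passing []         []         = []
  still-passing (x≢y ∷ x∉) (py ∷ pys) = remove-other {p = p} x≢y py ∷ still-passing x∉ pys

count-witness : ∀ {n k} (p : Fin n → Bool) → count p ≡ suc k → ∃[ i ] p i ≡ true
count-witness {suc n} p c with p zero in p0
... | true  = zero , p0
... | false with i , pi ← count-witness (λ i → p (suc i)) c = suc i , pi

-- A path is
-- recorded by the list of vertices it leaves from; it is elementary when this
-- list has no repetitions.
module Paths {A : Set} (_≟A_ : DecidableEquality A) (T : A → A → Set) where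
  open import Data.List.Membership.DecPropositional _≟A_ using (_∈?_)

  sources : ∀ {a b} → Star T a b → List A
  sources ε                = []
  sources (_◅_ {a} _ p) = a ∷ sources p

  sources-◅◅ : ∀ {a b c} (p : Star T a b) (q : Star T b c) → sources (p ◅◅ q) ≡ sources p ++ sources q
  sources-◅◅ ε       q = refl
  sources-◅◅ (_ ◅ p) q = cong (_ ∷_) (sources-◅◅ p q)

  split : ∀ {a b y} (p : Star T a b) → y ∈ sources p →
          Σ (Star T a y) λ p₁ → Σ A λ c → Σ (T y c) λ _ → Σ (Star T c b) λ p₂ →
            sources p ≡ sources p₁ ++ (y ∷ sources p₂)
  split (t ◅ p) (here refl) = ε , _ , t , p , refl
  split (t ◅ p) (there y∈)  with p₁ , c , t′ , p₂ , eq ← split p y∈ = t ◅ p₁ , c , t′ , p₂ , cong (_ ∷_) eq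

  Path⁺ : A → A → Set
  Path⁺ a b = Σ A λ c → T a c × Star T c b

  sources⁺ : ∀ {a b} → Path⁺ a b → List A
  sources⁺ {a} (_ , _ , p) = a ∷ sources p

  Cycle : A → Set
  Cycle a = Path⁺ a a

  -- Prepending a step to an elementary path, and cutting off the loop this may
  -- close, gives an elementary nonempty path through no new vertex.
  prepend : ∀ {a c b} → T a c → (q : Star T c b) → Unique (sources q) →
            Σ (Path⁺ a b) λ q′ → Unique (sources⁺ q′) × sources⁺ q′ ⊆ a ∷ sources q
  prepend {a} t q u with a ∈? sources q
  ... | no a∉ = (_ , t , q) , ¬Any⇒All¬ (sources q) a∉ ∷ u , ⊆-refl
  ... | yes a∈ with q₁ , c , t′ , q₂ , eq ← split q a∈ =
    (c , t′ , q₂) , unique-suffix (sources q₁) (subst Unique eq u) , λ x∈ → there (inner x∈)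
    where
    inner : a ∷ sources q₂ ⊆ sources q
    inner x∈ = subst (_ ∈_) (sym eq) (∈-++⁺ʳ (sources q₁) x∈)

  elementary : ∀ {a b} (p : Star T a b) → Σ (Star T a b) λ q → Unique (sources q) × sources q ⊆ sources p
  elementary ε = ε , [] , λ ()
  elementary (t ◅ p) with q , u , q⊆p ← elementary p with (_ , t′ , q′) , u′ , q′⊆ ← prepend t q u =
    t′ ◅ q′ , u′ , ⊆-trans q′⊆ (∷⁺ʳ _ q⊆p)

  elementary-cycle : ∀ {a} (c : Cycle a) → Σ (Cycle a) λ c′ → Unique (sources⁺ c′) × sources⁺ c′ ⊆ sources⁺ c
  elementary-cycle (_ , t , p) with q , u , q⊆p ← elementary p with c′ , u′ , c′⊆ ← prepend t q u =
    c′ , u′ , ⊆-trans c′⊆ (∷⁺ʳ _ q⊆p)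

  rotate : ∀ {a y} (c : Cycle a) → y ∈ sources⁺ c → Σ (Cycle y) λ c′ → sources⁺ c′ ⊆ sources⁺ c
  rotate c (here refl) = c , ⊆-refl
  rotate {a} {y} (_ , t , p) (there y∈) with p₁ , c , t′ , p₂ , eq ← split p y∈ =
    (c , t′ , p₂ ◅◅ (t ◅ p₁)) , rotated
    where
    rotated : y ∷ sources (p₂ ◅◅ (t ◅ p₁)) ⊆ a ∷ sources p
    rotated x∈ rewrite eq | sources-◅◅ p₂ (t ◅ p₁) with x∈
    ... | here refl = there (∈-++⁺ʳ (sources p₁) (here refl))
    ... | there x∈′ with ∈-++⁻ (sources p₂) x∈′
    ...   | inj₁ x∈p₂          = there (∈-++⁺ʳ (sources p₁) (there x∈p₂))
    ...   | inj₂ (here refl)   = here refl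
    ...   | inj₂ (there x∈p₁)  = there (∈-++⁺ˡ x∈p₁)

module Geometry (π : PreNet) (wf : WellFormed π) where
  open PreNet π
  open WellFormed wf

  In : Fin nB → Fin nL → Set
  In = Inside π

  clash : ∀ {l k k′} {A : Set} → kind l ≡ k → kind l ≡ k′ → k ≢ k′ → A
  clash kl kl′ k≢k′ = ⊥-elim (k≢k′ (trans (sym kl) kl′))

  principal-kind : ∀ {l X} → l ≡ principal X → kind l ≡ ofc
  principal-kind {X = X} refl = principal-ofc X

  distinct-sources : ∀ {e e′ k k′} → kind (src e) ≡ k → kind (src e′) ≡ k′ → k ≢ k′ → e ≢ e′
  distinct-sources ke ke′ k≢k′ refl = clash ke ke′ k≢k′

  unboxed : ∀ {l k} → kind l ≡ k → k ≢ ofc → k ≢ pax → border l ≡ nothing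
  unboxed {l} kl k≢ofc k≢pax with border l in bl
  ... | nothing = refl
  ... | just c with border-kind l c bl
  ...   | inj₁ l-ofc = clash kl l-ofc k≢ofc
  ...   | inj₂ l-pax = clash kl l-pax k≢pax

  SameBoxes : Fin nL → Fin nL → Set
  SameBoxes l l′ = (∀ b → In b l → In b l′) × (∀ b → In b l′ → In b l)

  same-sym : ∀ {l l′} → SameBoxes l l′ → SameBoxes l′ l
  same-sym (to , from) = from , to

  same-trans : ∀ {l l′ l″} → SameBoxes l l′ → SameBoxes l′ l″ → SameBoxes l l″
  same-trans (to , from) (to′ , from′) = (λ b → to′ b ∘ to b) , (λ b → from b ∘ from′ b)

  edge-same-boxes : ∀ {e t} → tgt e ≡ just t → border t ≡ nothing → SameBoxes (src e) t
  edge-same-boxes {e} {t} te bt = forward , λ b inb → box-prem-in b e t te (inj₁ inb)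
    where
    forward : ∀ b → In b (src e) → In b t
    forward b inb with box-concl-in b e inb
    ... | l , te′ , full with refl ← trans (sym te) te′ with full
    ...   | inj₁ inside = inside
    ...   | inj₂ bt′    = ⊥-elim (just≢nothing (trans (sym bt′) bt))

  border-same-boxes : ∀ {l l′ A} → border l ≡ just A → border l′ ≡ just A → SameBoxes l l′
  border-same-boxes bl bl′ = across bl bl′ , across bl′ bl
    where
    across : ∀ {l l′ A} → border l ≡ just A → border l′ ≡ just A → ∀ c → In c l → In c l′
    across {l} {l′} {A} bl bl′ c inc with c ≟ A
    ... | yes refl = ⊥-elim (true≢false (trans (sym inc) (border-outside l c bl)))
    ... | no c≢A with nesting c A c≢A
    ...   | inj₁ c⊆A        = ⊥-elim (true≢false (trans (sym (c⊆A l (inj₁ inc))) (border-outside l A bl)))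
    ...   | inj₂ (inj₁ A⊆c) = A⊆c l′ (inj₂ bl′)
    ...   | inj₂ (inj₂ c#A) = ⊥-elim (c#A l (inj₁ inc) (inj₂ bl))

  sharing-boxes : ∀ {a b l} → In a l → In b l →
                  a ≡ b ⊎ (∀ x → Full π a x → In b x) ⊎ (∀ x → Full π b x → In a x)
  sharing-boxes {a} {b} {l} inal inbl with a ≟ b
  ... | yes a≡b = inj₁ a≡b
  ... | no a≢b with nesting a b a≢b
  ...   | inj₁ a⊆b        = inj₂ (inj₁ a⊆b)
  ...   | inj₂ (inj₁ b⊆a) = inj₂ (inj₂ b⊆a)
  ...   | inj₂ (inj₂ a#b) = ⊥-elim (a#b l (inj₁ inal) (inj₁ inbl))

  inside-trans : ∀ {x b l} → In x (principal b) → In b l → In x l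
  inside-trans {x} {b} inx inb with x ≟ b
  ... | yes refl = ⊥-elim (true≢false (trans (sym inx) (border-outside _ x (principal-bord x))))
  ... | no x≢b with nesting x b x≢b
  ...   | inj₁ x⊆b        = ⊥-elim (true≢false (trans (sym (x⊆b _ (inj₁ inx))) (border-outside _ b (principal-bord b))))
  ...   | inj₂ (inj₁ b⊆x) = b⊆x _ (inj₁ inb)
  ...   | inj₂ (inj₂ x#b) = ⊥-elim (x#b _ (inj₁ inx) (inj₂ (principal-bord b)))

  principal-injective : ∀ {X Z} → principal X ≡ principal Z → X ≡ Z
  principal-injective {X} {Z} eq
    with refl ← trans (sym (principal-bord X)) (trans (cong border eq) (principal-bord Z)) = refl

  depth : Fin nB → ℕ
  depth b = count (λ c → inside c (principal b))

  depth-< : ∀ {b c} → In b (principal c) → depth b < depth c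
  depth-< {b} h = count-strict _ _ b (λ x inx → inside-trans inx h)
                    (border-outside (principal b) b (principal-bord b)) h

  directly-same : ∀ R {l l′} → SameBoxes l l′ → DirectlyIn π R l → DirectlyIn π R l′
  directly-same nothing  (to , from) out          b = ¬-not (λ inb → true≢false (trans (sym (from b inb)) (out b)))
  directly-same (just r) (to , from) (inr , top) = to r inr , λ c inc → top c (from c inc)

  Within : Region π → Fin nB → Set
  Within nothing  X = ⊤
  Within (just r) X = In r (principal X)

  directly⇒within : ∀ R {A} → DirectlyIn π R (principal A) → Within R A
  directly⇒within nothing  _          = tt
  directly⇒within (just r) (inr , _) = inr

  directly-not-inside : ∀ R {A X} → DirectlyIn π R (principal A) → Within R X → ¬ In X (principal A)
  directly-not-inside nothing  {X = X} out        _   inX = true≢false (trans (sym inX) (out X))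
  directly-not-inside (just r) {X = X} (_ , top) inr inX = top X inX inr

  -- Every link lies directly in some region: the deepest box containing it.
  innermost-region : ∀ l → ∃[ R ] DirectlyIn π R l
  innermost-region l with any? (λ b → inside b l ≟B true)
  ... | no none        = nothing , λ b → ¬-not (λ inb → none (b , inb))
  ... | yes (b₀ , inb₀) = just deepest , in-deepest , λ c inc deepest∋c →
          <-irrefl refl (<-≤-trans (depth-< deepest∋c) (lookup maximal (∈-filter⁺ _ (∈-allFin c) inc)))
    where
    around : List (Fin nB)
    around = filter (λ b → inside b l ≟B true) (allFin nB)
    deepest : Fin nB
    deepest = argmax depth b₀ around
    in-deepest : In deepest l
    in-deepest = argmax-all depth {P = λ b → In b l} inb₀ (all-filter _ (allFin nB))
    maximal : All (λ c → depth c ≤ depth deepest) around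
    maximal = f[xs]≤f[argmax] b₀ around

  branch-inside : ∀ {w e b} → BranchTo π w e → In b w → In b (src e)
  branch-inside {w} {e} {b} (here te) inw = box-prem-in b e w te (inj₁ inw)
  branch-inside {b = b} (there {e} {p = p} te _ se′ br) inw =
    box-prem-in b e p te (inj₁ (subst (In b) se′ (branch-inside br inw)))

  PaxExit : Fin nL → Fin nE → Set
  PaxExit w e = Σ (Fin nE) λ x → Σ (Fin nB) λ A →
    tgt x ≡ just w × border (src x) ≡ just A × kind (src x) ≡ pax × In A (src e)

  branch-exit : ∀ {w e} → BranchTo π w e → tgt e ≡ just w ⊎ PaxExit w e
  branch-exit (here te) = inj₁ te
  branch-exit (there {e} {e′} {p} te kp se′ br) with branch-exit br
  ... | inj₁ te′ with A , bA ← pax-has-box p kp =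
    inj₂ (e′ , A , te′ , subst (λ l → border l ≡ just A) (sym se′) bA ,
          subst (λ l → kind l ≡ pax) (sym se′) kp , box-prem-in A e p te (inj₂ bA))
  ... | inj₂ (x , A , tx , bx , kx , inA) =
    inj₂ (x , A , tx , bx , kx , box-prem-in A e p te (inj₁ (subst (In A) se′ inA)))

  vtx-border : ∀ {l b} → border l ≡ just b → vtx π l ≡ inj₂ b
  vtx-border {l} bl with border l
  vtx-border refl | just _ = refl

  walk-++ : ∀ {R S u v w es fs} → Walk π R S u v es → Walk π R S v w fs → Walk π R S u w (es ++ fs)
  walk-++ []      q = q
  walk-++ (j ∷ p) q = j ∷ walk-++ p q

  joins : ∀ {R S e s t} → src e ≡ s → DirectlyIn π R s → tgt e ≡ just t → kind t ≢ par → DirectlyIn π R t →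
          Joins π R S e (vtx π s) (vtx π t) × Joins π R S e (vtx π t) (vtx π s)
  joins {t = t} refl in-src te not-par in-t =
    (in-src , kept , t , te , in-t , inj₁ (refl , refl)) , (in-src , kept , t , te , in-t , inj₂ (refl , refl))
    where
    kept : ∀ {S} → Kept π S _
    kept t′ te′ kpar with refl ← trans (sym te) te′ = ⊥-elim (not-par kpar)

  premise-true : ∀ {e l} → tgt e ≡ just l → isPremOf π l e ≡ true
  premise-true {e} te with tgt e
  premise-true {l = l} refl | just .l = dec-true (l ≟ l) refl

  premise-tgt : ∀ {l e} → isPremOf π l e ≡ true → tgt e ≡ just l
  premise-tgt {l} {e} pe with tgt e
  ... | just t with t ≟ l
  ...   | yes refl = refl
  premise-tgt () | nothing

  -- Switchings exist as soon as there is an edge: each par link has two premises.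
  switching : Fin nE → Σ (Fin nL → Fin nE) (IsSwitching π)
  switching e₀ = S , λ l kpar → premise-tgt (choice-premise l (count-witness _ (proj₁ (arity l) 2 (cong premArity kpar))))
    where
    premise? : ∀ l → Dec (∃[ e ] isPremOf π l e ≡ true)
    premise? l = any? (λ e → isPremOf π l e ≟B true)
    choose : ∀ l → Dec (∃[ e ] isPremOf π l e ≡ true) → Fin nE
    choose l (yes (e , _)) = e
    choose l (no _)        = e₀
    S : Fin nL → Fin nE
    S l = choose l (premise? l)
    choice-premise : ∀ l → ∃[ e ] isPremOf π l e ≡ true → isPremOf π l (S l) ≡ true
    choice-premise l has with premise? l
    ... | yes (e , pe) = pe
    ... | no none      = ⊥-elim (none has)

  single-conclusion : ∀ {l d d′} → conclArity (kind l) ≡ 1 → src d ≡ l → src d′ ≡ l → d ≡ d′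
  single-conclusion {l} {d} {d′} one sd sd′ with d ≟ d′
  ... | yes d≡d′ = d≡d′
  ... | no d≢d′  = ⊥-elim (two≰one (subst (2 ≤_) (trans (proj₂ (arity l)) one)
                     (count-distinct (isConclOf π l) (d ∷ d′ ∷ []) ((d≢d′ ∷ []) ∷ [] ∷ [])
                        (dec-true (src d ≟ l) sd ∷ dec-true (src d′ ≟ l) sd′ ∷ []))))
    where
    two≰one : ¬ 2 ≤ 1
    two≰one (s≤s ())

  binary-premises : ∀ {k e₁ e₂ e₃} → premArity (kind k) ≡ just 2 →
                    tgt e₁ ≡ just k → tgt e₂ ≡ just k → tgt e₃ ≡ just k →
                    e₁ ≢ e₂ → e₁ ≢ e₃ → e₂ ≢ e₃ → ⊥
  binary-premises {k} {e₁} {e₂} {e₃} two t₁ t₂ t₃ e₁≢e₂ e₁≢e₃ e₂≢e₃ =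
    three≰two (subst (3 ≤_) (proj₁ (arity k) 2 two)
      (count-distinct (isPremOf π k) (e₁ ∷ e₂ ∷ e₃ ∷ []) ((e₁≢e₂ ∷ e₁≢e₃ ∷ []) ∷ (e₂≢e₃ ∷ []) ∷ [] ∷ [])
        (premise-true t₁ ∷ premise-true t₂ ∷ premise-true t₃ ∷ [])))
    where
    three≰two : ¬ 3 ≤ 2
    three≰two (s≤s (s≤s ()))

  CutWith : Fin nL → Fin nB → Set
  CutWith w X = kind w ≡ wn × ∃[ d ] ∃[ k ] ∃[ c ]
    (src d ≡ w × tgt d ≡ just k × kind k ≡ cut × src c ≡ principal X × tgt c ≡ just k × d ≢ c)

  cut-with-unique : ∀ {w X Z} → CutWith w X → CutWith w Z → X ≡ Z
  cut-with-unique (kw , d , k , c , sd , td , kk , sc , tc , d≢c) (_ , d′ , k′ , c′ , sd′ , td′ , _ , sc′ , tc′ , d′≢c′)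
    with c ≟ c′
  ... | yes refl = principal-injective (trans (sym sc) sc′)
  ... | no c≢c′ with refl ← single-conclusion (cong conclArity kw) sd sd′ with refl ← trans (sym td) td′ =
    ⊥-elim (binary-premises (cong premArity kk) tc tc′ td c≢c′ (d≢c ∘ sym) (d′≢c′ ∘ sym))

  -- The edges of the switching path built from a step X ≺₁ X′ all point back to X:
  -- the conclusion of the principal port of X, the conclusion of the why not link
  -- cut with it, and an edge from a pax link into that why not link.
  Tag : Fin nE → Fin nB → Set
  Tag e X = src e ≡ principal X ⊎ CutWith (src e) X ⊎ (kind (src e) ≡ pax × ∃[ w ] (tgt e ≡ just w × CutWith w X))

  tag-unique : ∀ {e X Z} → Tag e X → Tag e Z → X ≡ Z
  tag-unique (inj₁ sX) (inj₁ sZ) = principal-injective (trans (sym sX) sZ)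
  tag-unique (inj₂ (inj₁ cX)) (inj₂ (inj₁ cZ)) = cut-with-unique cX cZ
  tag-unique (inj₂ (inj₂ (_ , w , tw , cX))) (inj₂ (inj₂ (_ , w′ , tw′ , cZ)))
    with refl ← trans (sym tw) tw′ = cut-with-unique cX cZ
  tag-unique (inj₁ sX) (inj₂ (inj₁ (kw , _)))     = clash (principal-kind sX) kw λ ()
  tag-unique (inj₁ sX) (inj₂ (inj₂ (kp , _)))     = clash (principal-kind sX) kp λ ()
  tag-unique (inj₂ (inj₁ (kw , _))) (inj₁ sZ)     = clash (principal-kind sZ) kw λ ()
  tag-unique (inj₂ (inj₁ (kw , _))) (inj₂ (inj₂ (kp , _))) = clash kw kp λ ()
  tag-unique (inj₂ (inj₂ (kp , _))) (inj₁ sZ)     = clash (principal-kind sZ) kp λ ()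
  tag-unique (inj₂ (inj₂ (kp , _))) (inj₂ (inj₁ (kw , _))) = clash kw kp λ ()

module Steps (π : PreNet) (wf : WellFormed π) (I : Fin (PreNet.nE π) → ℤ) where
  open PreNet π
  open WellFormed wf
  open Geometry π wf

  _≺₁_ : Fin nB → Fin nB → Set
  _≺₁_ = Prec1 π I

  -- What the argument uses of a step X ≺₁ X′:
  -- the principal port of X is cut by c, d with the why not link w, and X′
  -- contains a link f whose exponential branch, starting with e, ends in w.
  record Shape (X X′ : Fin nB) : Set where
    field
      c d e  : Fin nE
      k w f  : Fin nL
      c-src  : src c ≡ principal X
      c-tgt  : tgt c ≡ just k
      k-cut  : kind k ≡ cut
      d-tgt  : tgt d ≡ just k
      d≢c    : d ≢ c
      d-src  : src d ≡ w
      w-wn   : kind w ≡ wn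
      f-in   : In X′ f
      e-src  : src e ≡ f
      branch : BranchTo π w e

  shape : ∀ {X X′} → X ≺₁ X′ → Shape X X′
  shape (c , _ , k , d , w , c-src , _ , _ , c-tgt , k-cut , d-tgt , d≢c , d-src , w-wn , f , f-in , _ , _ , e , e-src , branch) =
    record { c = c ; d = d ; e = e ; k = k ; w = w ; f = f ; c-src = c-src ; c-tgt = c-tgt ; k-cut = k-cut
           ; d-tgt = d-tgt ; d≢c = d≢c ; d-src = d-src ; w-wn = w-wn ; f-in = f-in ; e-src = e-src ; branch = branch }

  module _ {X X′ : Fin nB} (s : Shape X X′) where
    open Shape s

    w-unboxed : border w ≡ nothing
    w-unboxed = unboxed w-wn (λ ()) (λ ())

    principal~k : SameBoxes (principal X) k
    principal~k = subst (λ l → SameBoxes l k) c-src (edge-same-boxes c-tgt (unboxed k-cut (λ ()) (λ ())))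

    k~w : SameBoxes k w
    k~w = same-sym (subst (λ l → SameBoxes l k) d-src (edge-same-boxes d-tgt (unboxed k-cut (λ ()) (λ ()))))

    principal~w : SameBoxes (principal X) w
    principal~w = same-trans principal~k k~w

    cut-with : CutWith w X
    cut-with = w-wn , d , k , c , d-src , d-tgt , k-cut , c-src , c-tgt , d≢c

    encloses-f : ∀ b → In b (principal X) → In b f
    encloses-f b inb = subst (In b) e-src (branch-inside branch (proj₁ principal~w b inb))

  within-direct : ∀ R {A X′ l} → DirectlyIn π R (principal A) → Within R X′ → In A l → In X′ l →
                  X′ ≡ A ⊎ In A (principal X′)
  within-direct R A-direct X′-within inA inX′ with sharing-boxes inA inX′
  ... | inj₁ A≡X′          = inj₁ (sym A≡X′)
  ... | inj₂ (inj₁ A⊆X′)   = ⊥-elim (directly-not-inside R A-direct X′-within (A⊆X′ _ (inj₂ (principal-bord _))))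
  ... | inj₂ (inj₂ X′⊆A)   = inj₂ (X′⊆A _ (inj₂ (principal-bord _)))

  step-inside : ∀ R {A X X′} → DirectlyIn π R (principal A) → Within R X′ → In A (principal X) → X ≺₁ X′ →
                X′ ≡ A ⊎ In A (principal X′)
  step-inside R A-direct X′-within inA step =
    within-direct R A-direct X′-within (encloses-f (shape step) _ inA) (Shape.f-in (shape step))

  within-step : ∀ R {Y X X′} → DirectlyIn π R (principal Y) → depth Y ≤ depth X′ → Within R X → X ≺₁ X′ → Within R X′
  within-step nothing  _ _ _ _ = tt
  within-step (just r) {X′ = X′} (r∋Y , _) Y≤X′ r∋X step
    with sharing-boxes (encloses-f (shape step) r r∋X) (Shape.f-in (shape step))
  ... | inj₁ refl        = ⊥-elim (<-irrefl refl (<-≤-trans (depth-< r∋Y) Y≤X′))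
  ... | inj₂ (inj₁ r⊆X′) = ⊥-elim (<-irrefl refl (<-trans (depth-< (r⊆X′ _ (inj₂ (principal-bord r))))
                                                           (<-≤-trans (depth-< r∋Y) Y≤X′)))
  ... | inj₂ (inj₂ X′⊆r) = X′⊆r _ (inj₂ (principal-bord X′))

  -- From a step X ≺₁ X′ with X directly in R and X′ in R: the exponential branch
  -- leaves through a pax port of a box A lying directly in R and around X′, and
  -- X —c— k —d— w —x— A is a path, tagged by X, in every switching graph of R.
  record Segment (R : Region π) (S : Fin nL → Fin nE) (X X′ : Fin nB) : Set where
    field
      exit        : Fin nB
      exit-direct : DirectlyIn π R (principal exit)
      exit-around : X′ ≡ exit ⊎ In exit (principal X′)
      first       : Fin nE
      rest        : List (Fin nE)
      walk        : Walk π R S (inj₂ X) (inj₂ exit) (first ∷ rest)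
      distinct    : Unique (first ∷ rest)
      tagged      : All (λ e → Tag e X) (first ∷ rest)

  segment : ∀ R S {X X′} → DirectlyIn π R (principal X) → Within R X′ → X ≺₁ X′ → Segment R S X X′
  segment R S {X} {X′} X-direct X′-within step with branch-exit (Shape.branch (shape step))
  ... | inj₁ e-tgt = ⊥-elim (directly-not-inside R X-direct X′-within X′∋X)
    where
    s : Shape X X′
    s = shape step
    open Shape s
    X′∋X : In X′ (principal X)
    X′∋X = proj₂ (principal~w s) X′ (proj₁ (edge-same-boxes e-tgt (w-unboxed s)) X′ (subst (In X′) (sym e-src) f-in))
  ... | inj₂ (x , A , x-tgt , x-border , x-pax , A∋e) = record
    { exit = A ; exit-direct = A-direct ; exit-around = within-direct R A-direct X′-within A∋f f-in
    ; first = c ; rest = d ∷ x ∷ []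
    ; walk = c-step ∷ d-step ∷ x-step ∷ []
    ; distinct = (c≢d ∷ c≢x ∷ []) ∷ (d≢x ∷ []) ∷ [] ∷ []
    ; tagged = inj₁ c-src ∷ inj₂ (inj₁ (subst (λ l → CutWith l X) (sym d-src) X-cut))
             ∷ inj₂ (inj₂ (x-pax , w , x-tgt , X-cut)) ∷ []
    }
    where
    s : Shape X X′
    s = shape step
    open Shape s
    X-cut : CutWith w X
    X-cut = cut-with s
    A∋f : In A f
    A∋f = subst (In A) e-src A∋e
    k-direct : DirectlyIn π R k
    k-direct = directly-same R (principal~k s) X-direct
    w-direct : DirectlyIn π R w
    w-direct = directly-same R (k~w s) k-direct
    x-direct : DirectlyIn π R (src x)
    x-direct = directly-same R (same-sym (edge-same-boxes x-tgt (w-unboxed s))) w-direct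
    A-direct : DirectlyIn π R (principal A)
    A-direct = directly-same R (border-same-boxes x-border (principal-bord A)) x-direct
    c-step : Joins π R S c (inj₂ X) (vtx π k)
    c-step = subst (λ u → Joins π R S c u (vtx π k)) (vtx-border (principal-bord X))
               (proj₁ (joins c-src X-direct c-tgt (λ kpar → clash k-cut kpar λ ()) k-direct))
    d-step : Joins π R S d (vtx π k) (vtx π w)
    d-step = proj₂ (joins d-src w-direct d-tgt (λ kpar → clash k-cut kpar λ ()) k-direct)
    x-step : Joins π R S x (vtx π w) (inj₂ A)
    x-step = subst (Joins π R S x (vtx π w)) (vtx-border x-border)
               (proj₂ (joins refl x-direct x-tgt (λ kpar → clash w-wn kpar λ ()) w-direct))
    c≢d : c ≢ d
    c≢d = distinct-sources (principal-kind c-src) (subst (λ l → kind l ≡ wn) (sym d-src) w-wn) λ ()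
    c≢x : c ≢ x
    c≢x = distinct-sources (principal-kind c-src) x-pax λ ()
    d≢x : d ≢ x
    d≢x = distinct-sources (subst (λ l → kind l ≡ wn) (sym d-src) w-wn) x-pax λ ()

  open Paths _≟_ _≺₁_

  TaggedBy : List (Fin nB) → Fin nE → Set
  TaggedBy zs e = ∃[ Z ] (Z ∈ zs × Tag e Z)

  retag : ∀ {zs zs′ e} → zs ⊆ zs′ → TaggedBy zs e → TaggedBy zs′ e
  retag zs⊆zs′ (Z , Z∈zs , tag) = Z , zs⊆zs′ Z∈zs , tag

  tags-disjoint : ∀ {X zs es fs} → ¬ X ∈ zs → All (λ e → Tag e X) es → All (TaggedBy zs) fs → Disjoint es fs
  tags-disjoint X∉zs tagsX tagsZ (e∈es , e∈fs) with Z , Z∈zs , tagZ ← lookup tagsZ e∈fs =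
    X∉zs (subst (_∈ _) (sym (tag-unique (lookup tagsX e∈es) tagZ)) Z∈zs)

  module Chain (R : Region π) (S : Fin nL → Fin nE) (Y : Fin nB) (Y-direct : DirectlyIn π R (principal Y)) where

    Deep : List (Fin nB) → Set
    Deep = All (λ z → depth Y ≤ depth z)

    deep-start : ∀ {X} (p : Star _≺₁_ X Y) → Deep (sources p) → depth Y ≤ depth X
    deep-start ε       _            = ≤-refl
    deep-start (_ ◅ _) (Y≤X ∷ _) = Y≤X

    WalkTo : Fin nB → List (Fin nB) → Set
    WalkTo A zs = Σ (List (Fin nE)) λ es → Walk π R S (inj₂ A) (inj₂ Y) es × Unique es × All (TaggedBy zs) es

    WalkTo⁺ : Fin nB → List (Fin nB) → Set
    WalkTo⁺ A zs = Σ (Fin nE) λ e → Σ (List (Fin nE)) λ es →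
      Walk π R S (inj₂ A) (inj₂ Y) (e ∷ es) × Unique (e ∷ es) × All (TaggedBy zs) (e ∷ es)

    -- Starting from X equal to, or inside, a box A directly in R; steps inside A are skipped.
    walk-via : ∀ {X} (p : Star _≺₁_ X Y) A → DirectlyIn π R (principal A) → X ≡ A ⊎ In A (principal X) → Within R X →
               Unique (sources p) → Deep (sources p) → WalkTo A (sources p)

    walk-from : ∀ {X X′} (step : X ≺₁ X′) (p : Star _≺₁_ X′ Y) → DirectlyIn π R (principal X) → Within R X →
                Unique (sources (step ◅ p)) → Deep (sources (step ◅ p)) → WalkTo⁺ X (sources (step ◅ p))
    walk-from {X} step p X-direct X-within (X∉ ∷ u) (_ ∷ deep)
      with X′-within ← within-step R Y-direct (deep-start p deep) X-within step
      with seg ← segment R S X-direct X′-within step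
      with es , w , u′ , tags ← walk-via p (Segment.exit seg) (Segment.exit-direct seg) (Segment.exit-around seg)
                                          X′-within u deep =
      first , rest ++ es , walk-++ walk w ,
      Unique.++⁺ distinct u′ (tags-disjoint (All¬⇒¬Any X∉) tagged tags) ,
      All.++⁺ (All.map (λ tag → X , here refl , tag) tagged) (All.map (retag there) tags)
      where open Segment seg

    walk-via ε A A-direct (inj₁ refl) _ _ _ = [] , [] , [] , []
    walk-via ε A A-direct (inj₂ A∋Y)  _ _ _ = ⊥-elim (directly-not-inside R Y-direct (directly⇒within R A-direct) A∋Y)
    walk-via (step ◅ p) A A-direct (inj₁ refl) X-within u deep
      with e , es , w , u′ , tags ← walk-from step p A-direct X-within u deep = e ∷ es , w , u′ , tags
    walk-via (step ◅ p) A A-direct (inj₂ A∋X) X-within (_ ∷ u) (_ ∷ deep)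
      with X′-within ← within-step R Y-direct (deep-start p deep) X-within step
      with es , w , u′ , tags ← walk-via p A A-direct (step-inside R A-direct X′-within A∋X step) X′-within u deep =
      es , w , u′ , All.map (retag there) tags

  shallowest-elementary : ∀ {B} → Cycle B →
    ∃[ Y ] Σ (Cycle Y) λ c → Unique (sources⁺ c) × All (λ z → depth Y ≤ depth z) (sources⁺ c)
  shallowest-elementary {B} c@(_ , _ , p) =
    let (c₁ , c₁⊆c)       = rotate c Y∈c
        (c₂ , u , c₂⊆c₁) = elementary-cycle c₁
    in Y , c₂ , u , anti-mono (⊆-trans c₂⊆c₁ c₁⊆c)
                              (f[argmin]≤f[⊤] {f = depth} B (sources p) ∷ f[argmin]≤f[xs] {f = depth} B (sources p))
    where
    Y : Fin nB
    Y = argmin depth B (sources p)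
    Y∈c : Y ∈ sources⁺ c
    Y∈c with argmin-sel depth B (sources p)
    ... | inj₁ Y≡B  = here Y≡B
    ... | inj₂ Y∈p = there Y∈p

  -- In a correct net, ≺₁ has no cycles: follow an elementary cycle from a
  -- shallowest box Y in the switching graph of the region where Y lies.
  acyclic : Correct π → ∀ {B} → Cycle B → ⊥
  acyclic correct c
    with Y , (_ , step , p) , u , deep ← shallowest-elementary c
    with R , Y-direct ← innermost-region (principal Y)
    with S , S-switching ← switching (Shape.c (shape step))
    with e , es , w , u′ , _ ← Chain.walk-from R S Y Y-direct step p Y-direct (directly⇒within R Y-direct) u deep =
    correct R S S-switching (inj₂ Y , e , es , w , u′)

-- Reflexivity and transitivity hold for any
-- reflexive-transitive closure; a proof of B ⪯ C ⪯ B with B ≢ C would contain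
-- a ≺₁-cycle.
mainTheorem11 : (π : PreNet) → ProofNet π → mL3 π →
    (I : Fin (PreNet.nE π) → ℤ) → Canonical π I →
    IsPartialOrder _≡_ (Preceq π I)
mainTheorem11 π (wf , correct) _ I _ = record
  { isPreorder = isPreorder (Prec1 π I)
  ; antisym    = antisym
  }
  where
  open Steps π wf I using (acyclic)
  antisym : Antisymmetric _≡_ (Preceq π I)
  antisym ε          _ = refl
  antisym (step ◅ p) q = ⊥-elim (acyclic correct (_ , step , p ◅◅ q))
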